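{- Let $G$ be a graph and $F\subseteq E(G)$ such that $G/F$ is a cactus, and let $\mathcal{W}$ be the $G/F$-witness structure of $G$. Then there exists a coloring $f:V(G)\to\{1,2,3\}$ which is compatible with $\mathcal{W}$.
   Context: A cactus is a connected graph in which every edge lies in at most one cycle. A graph $G$ is contractible to $H$ via a surjection $\psi:V(G)\to V(H)$ if for each $h\in V(H)$ the set $W(h)=\psi^{ -1}(h)$ induces a connected subgraph of $G$, and $h,h'$ are adjacent in $H$ iff some edge of $G$ joins $W(h)$ and $W(h')$; the $H$-witness structure is $\mathcal{W}=\{W(h):h\in V(H)\}$ and its members are witness sets; a witness set is big if it has at least two vertices. For $F\subseteq E(G)$, $G/F$ is the graph obtained by taking the partition of $V(G)$ whose parts are the vertex sets of the connected components of the graph $(V(F),F)$ together with singletons for vertices not in $V(F)$, with one vertex per part and two parts adjacent iff some edge of $G$ joins them; its witness structure is this partition. A cable path in $G$ is a path $(v_1,\dots,v_q)$ such that $N_G(v_i)=\{v_{i-1},v_{i+1}\}$ for every $2\le i\le q-1$. For a graph $G$ with $T$-witness structure $\mathcal{W}$, a coloring $f:V(G)\to\{1,2,3\}$ is compatible with $\mathcal{W}$ if: (1) every witness set $W(t)$ is monochromatic (so $f(W(t))$ is well defined); (2) for every edge $t_xt_y\in E(T)$ with $W(t_x),W(t_y)$ both big, $f(W(t_x))\neq f(W(t_y))$; (3) for every cable path $(t_x,t_1,\dots,t_q,t_y)$ in $T$ with $W(t_x),W(t_y)$ big and $W(t_i)$ singletons for all $1\le i\le q$, we have $f(W(t_x))\ne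 f(W(t_1))$ and $f(W(t_y))\ne f(W(t_q))$. -}

module Defs where

open import Level using (0ℓ)
open import Data.Nat using (ℕ; zero; suc; _+_; _∸_; _<_; _≤_)
open import Data.Fin using (Fin)
open import Data.Product using (Σ; ∃; ∃-syntax; _×_; _,_)
open import Data.Sum using (_⊎_)
open import Relation.Nullary using (¬_)
open import Relation.Binary using (Rel; Decidable; Symmetric; Irreflexive)
open import Relation.Binary.PropositionalEquality using (_≡_; _≢_)
open import Relation.Binary.Construct.Closure.ReflexiveTransitive using (Star)
open import Function.Bundles using (_⇔_)

record Graph (n : ℕ) : Set₁ where
  field
    Adj   : Rel (Fin n) 0ℓ
    adj?  : Decidable Adj
    sym   : Symmetric Adj
    irrefl : Irreflexive _≡_ Adj
open Graph public

record EdgeSet {n : ℕ} (G : Graph n) : Set₁ where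
  field
    In    : Rel (Fin n) 0ℓ
    in?   : Decidable In
    insym : Symmetric In
    sub   : ∀ {u v} → In u v → Adj G u v
open EdgeSet public

Connected : ∀ {m} → Graph m → Set
Connected H = ∀ u v → Star (Adj H) u v

IsPath : ∀ {m} → Graph m → ℕ → (ℕ → Fin m) → Set
IsPath H L p =
  (∀ i j → i < L → j < L → p i ≡ p j → i ≡ j) ×
  (∀ i → suc i < L → Adj H (p i) (p (suc i)))

IsCablePath : ∀ {m} → Graph m → ℕ → (ℕ → Fin m) → Set
IsCablePath H L p =
  IsPath H L p ×
  (∀ i → suc (suc i) < L → ∀ w →
     Adj H (p (suc i)) w ⇔ (w ≡ p i ⊎ w ≡ p (suc (suc i))))

IsCycle : ∀ {m} → Graph m → ℕ → (ℕ → Fin m) → Set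
IsCycle H L p = 3 ≤ L × IsPath H L p × Adj H (p (L ∸ 1)) (p 0)

CycleEdge : ∀ {m} → ℕ → (ℕ → Fin m) → Fin m → Fin m → Set
CycleEdge L p u v =
  (∃[ i ] (suc i < L × ((u ≡ p i × v ≡ p (suc i)) ⊎ (u ≡ p (suc i) × v ≡ p i))))
  ⊎ ((u ≡ p (L ∸ 1) × v ≡ p 0) ⊎ (u ≡ p 0 × v ≡ p (L ∸ 1)))

IsCactus : ∀ {m} → Graph m → Set
IsCactus H =
  Connected H ×
  (∀ L p L' p' u v → IsCycle H L p → IsCycle H L' p' →
     CycleEdge L p u v → CycleEdge L' p' u v →
     ∀ x y → CycleEdge L p x y ⇔ CycleEdge L' p' x y)

-- H together with ψ : V(G) → V(H) is (a copy of) G/F: ψ is surjective, its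
-- fibres (the witness sets) are exactly the vertex sets of the connected
-- components of (V(F), F) together with singletons (i.e. the classes of
-- F-reachability), and distinct h, h' are adjacent in H iff some edge of G
-- joins W(h) and W(h').
IsContraction : ∀ {n m} (G : Graph n) → EdgeSet G → Graph m → (Fin n → Fin m) → Set
IsContraction G F H ψ =
  (∀ h → ∃[ u ] ψ u ≡ h) ×
  (∀ u v → (ψ u ≡ ψ v) ⇔ Star (In F) u v) ×
  (∀ h h' → Adj H h h' ⇔ (h ≢ h' × ∃[ u ] ∃[ v ] (ψ u ≡ h × ψ v ≡ h' × Adj G u v)))

Big : ∀ {n m} → (Fin n → Fin m) → Fin m → Set
Big ψ t = ∃[ u ] ∃[ v ] (u ≢ v × ψ u ≡ t × ψ v ≡ t)

Singleton : ∀ {n m} → (Fin n → Fin m) → Fin m → Set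
Singleton ψ t = ∃[ u ] (ψ u ≡ t × (∀ v → ψ v ≡ t → v ≡ u))

Compatible : ∀ {n m} → Graph m → (Fin n → Fin m) → (Fin n → Fin 3) → Set
Compatible T ψ f =
  (∀ u v → ψ u ≡ ψ v → f u ≡ f v) ×
  (∀ u v → Adj T (ψ u) (ψ v) → Big ψ (ψ u) → Big ψ (ψ v) → f u ≢ f v) ×
  -- (3) cable path (t_x, t_1, …, t_q, t_y), q = k + 1 ≥ 1, given as p 0, …, p (k + 2)
  (∀ k p → IsCablePath T (3 + k) p →
     Big ψ (p 0) → Big ψ (p (2 + k)) →
     (∀ i → 1 ≤ i → i ≤ 1 + k → Singleton ψ (p i)) →
     (∀ u v → ψ u ≡ p 0 → ψ v ≡ p 1 → f u ≢ f v) ×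
     (∀ u v → ψ u ≡ p (2 + k) → ψ v ≡ p (1 + k) → f u ≢ f v))

{-# OPTIONS --safe #-}
-- Every cactus H is 2-degenerate: in the subgraph induced by a nonempty S, let
-- (p 0, …, p (L ∸ 1)) be a path in S that cannot be extended at p 0. All
-- S-neighbours of p 0 lie on the path, and two of them p i, p j with 2 ≤ i < j
-- would close two different cycles through the edge p 0 p 1. Greedy colouring
-- along a degeneracy order therefore properly 3-colours H = G/F, and pulling a
-- proper colouring of H back along ψ gives a compatible colouring: conditions
-- (2) and (3) only ask for different colours across edges of H.
module Submission where

open import Defs
open import Data.Nat using (ℕ; zero; suc; _+_; _<_; _≤_; z≤n; s≤s; _≤?_)
open import Data.Nat.Properties
  using ( ≤-refl; ≤-pred; <-≤-trans; ≤-<-trans; <-trans; <-irrefl; <⇒≤; ≰⇒>; <-cmp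
        ; n≮n; n≮0; 0≢1+n; n<1⇒n≡0; +-suc; m≤m+n; anyUpTo?)
open import Data.Nat.Induction using (<-wellFounded)
open import Induction.WellFounded using (Acc; acc)
open import Data.Fin using (Fin; toℕ)
open import Data.Fin.Patterns using (0F; 1F; 2F)
open import Data.Fin.Properties using (any?; pigeonhole; toℕ<n) renaming (_≟_ to _≟ᶠ_)
open import Data.Fin.Subset using (Subset; _∈_; _-_; ⊤; Nonempty; ∣_∣)
open import Data.Fin.Subset.Properties
  using (_∈?_; nonempty?; ∈⊤; x∈p⇒∣p-x∣<∣p∣; x∈p∧x≢y⇒x∈p-y)
open import Data.Vec.Functional using (updateAt)
open import Data.Vec.Functional.Properties using (updateAt-updates; updateAt-minimal)
open import Data.Product using (∃-syntax; _×_; _,_; proj₁; proj₂)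
open import Data.Sum using (_⊎_; inj₁; inj₂)
open import Data.Empty using (⊥; ⊥-elim)
open import Function using (_∘_; const)
open import Function.Bundles using (_⇔_; Equivalence)
open import Relation.Nullary using (¬_; Dec; yes; no)
open import Relation.Nullary.Decidable using (_×-dec_; ¬?; decidable-stable)
open import Relation.Binary using (tri<; tri≈; tri>)
open import Relation.Binary.PropositionalEquality
  using (_≡_; _≢_; refl; trans; cong; subst; subst₂) renaming (sym to ≡-sym)

infixl 9 _[_]

_[_] : ∀ {m} → Graph m → Subset m → Graph m
G [ S ] = record
  { Adj    = λ u w → u ∈ S × w ∈ S × Adj G u w
  ; adj?   = λ u w → u ∈? S ×-dec (w ∈? S ×-dec adj? G u w)
  ; sym    = λ (u∈S , w∈S , u~w) → w∈S , u∈S , sym G u~w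
  ; irrefl = λ u≡w (_ , _ , u~w) → irrefl G u≡w u~w
  }

ProperColouring : ∀ {m k} → Graph m → (Fin m → Fin k) → Set
ProperColouring G c = ∀ {u w} → Adj G u w → c u ≢ c w

AtMostTwoNeighbours : ∀ {m} → Graph m → Fin m → Set
AtMostTwoNeighbours G v = ∃[ a ] ∃[ b ] (∀ w → Adj G v w → w ≡ a ⊎ w ≡ b)

TwoDegenerate : ∀ {m} → Graph m → Set
TwoDegenerate G = ∀ S → Nonempty S → ∃[ v ] (v ∈ S × AtMostTwoNeighbours (G [ S ]) v)

third-colour : (x y : Fin 3) → ∃[ z ] (z ≢ x × z ≢ y)
third-colour 0F 0F = 1F , (λ ()) , (λ ())
third-colour 0F 1F = 2F , (λ ()) , (λ ())
third-colour 0F 2F = 1F , (λ ()) , (λ ())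
third-colour 1F 0F = 2F , (λ ()) , (λ ())
third-colour 1F 1F = 0F , (λ ()) , (λ ())
third-colour 1F 2F = 0F , (λ ()) , (λ ())
third-colour 2F 0F = 1F , (λ ()) , (λ ())
third-colour 2F 1F = 0F , (λ ()) , (λ ())
third-colour 2F 2F = 0F , (λ ()) , (λ ())

module Greedy {m} (G : Graph m) where

  module _ {S v a b z} {c : Fin m → Fin 3}
           (nbrs : ∀ w → Adj (G [ S ]) v w → w ≡ a ⊎ w ≡ b) (z≢ca : z ≢ c a) (z≢cb : z ≢ c b) where

    recoloured-vertex-differs : ∀ {w} → Adj (G [ S ]) v w →
      updateAt c v (const z) v ≢ updateAt c v (const z) w
    recoloured-vertex-differs {w} v~w
      rewrite updateAt-updates v {const z} c
            | updateAt-minimal w v {const z} c (λ { refl → irrefl (G [ S ]) refl v~w }) =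
      z≢neighbour (nbrs w v~w)
      where
      z≢neighbour : w ≡ a ⊎ w ≡ b → z ≢ c w
      z≢neighbour (inj₁ refl) = z≢ca
      z≢neighbour (inj₂ refl) = z≢cb

    recolour-proper : ProperColouring (G [ S - v ]) c →
      ProperColouring (G [ S ]) (updateAt c v (const z))
    recolour-proper proper {u} {w} u~w@(u∈S , w∈S , _) with u ≟ᶠ v | w ≟ᶠ v
    ... | yes refl | _        = recoloured-vertex-differs u~w
    ... | no _     | yes refl = recoloured-vertex-differs (sym (G [ S ]) u~w) ∘ ≡-sym
    ... | no u≢v   | no w≢v
      rewrite updateAt-minimal u v {const z} c u≢v | updateAt-minimal w v {const z} c w≢v =
      proper (x∈p∧x≢y⇒x∈p-y u∈S u≢v , x∈p∧x≢y⇒x∈p-y w∈S w≢v , proj₂ (proj₂ u~w))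

  colour-subset : TwoDegenerate G → ∀ S → Acc _<_ ∣ S ∣ → ∃[ c ] ProperColouring (G [ S ]) c
  colour-subset degenerate S (acc smaller) with nonempty? S
  ... | no S-empty = const 0F , λ (u∈S , _) → ⊥-elim (S-empty (_ , u∈S))
  ... | yes S-nonempty with degenerate S S-nonempty
  ... | v , v∈S , a , b , nbrs
    with colour-subset degenerate (S - v) (smaller (x∈p⇒∣p-x∣<∣p∣ v∈S))
  ... | c , proper with third-colour (c a) (c b)
  ... | z , z≢ca , z≢cb = updateAt c v (const z) , recolour-proper nbrs z≢ca z≢cb proper

  twoDegenerate⇒3-colourable : TwoDegenerate G → ∃[ c ] ProperColouring G c
  twoDegenerate⇒3-colourable degenerate with colour-subset degenerate ⊤ (<-wellFounded _)
  ... | c , proper = c , λ u~w → proper (∈⊤ , ∈⊤ , u~w)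

open Greedy using (twoDegenerate⇒3-colourable)

OnPath : ∀ {m} → ℕ → (ℕ → Fin m) → Fin m → Set
OnPath L p w = ∃[ i ] (i < L × p i ≡ w)

on-path? : ∀ {m} L (p : ℕ → Fin m) w → Dec (OnPath L p w)
on-path? L p w = anyUpTo? (λ i → p i ≟ᶠ w) L

module Paths {m} (G : Graph m) where

  path-length≤ : ∀ {L p} → IsPath G L p → L ≤ m
  path-length≤ {L} {p} (injective , _) with L ≤? m
  ... | yes L≤m = L≤m
  ... | no L≰m with pigeonhole (≰⇒> L≰m) (p ∘ toℕ)
  ... | i , j , i<j , pi≡pj = ⊥-elim (<-irrefl (injective _ _ (toℕ<n i) (toℕ<n j) pi≡pj) i<j)

  path-prefix : ∀ {L p k} → IsPath G L p → k ≤ L → IsPath G k p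
  path-prefix (injective , step) k≤L =
    (λ i j i<k j<k → injective i j (<-≤-trans i<k k≤L) (<-≤-trans j<k k≤L)) ,
    (λ i i+1<k → step i (<-≤-trans i+1<k k≤L))

  _◃_ : Fin m → (ℕ → Fin m) → ℕ → Fin m
  (w ◃ p) zero    = w
  (w ◃ p) (suc i) = p i

  prepend-path : ∀ {L p w} → IsPath G (suc L) p → Adj G w (p 0) → ¬ OnPath (suc L) p w →
    IsPath G (suc (suc L)) (w ◃ p)
  prepend-path {L} {p} {w} (injective , step) w~p0 w∉p = injective′ , step′
    where
    injective′ : ∀ i j → i < suc (suc L) → j < suc (suc L) → (w ◃ p) i ≡ (w ◃ p) j → i ≡ j
    injective′ zero    zero    _   _   _  = refl
    injective′ zero    (suc j) _   j<  eq = ⊥-elim (w∉p (j , ≤-pred j< , ≡-sym eq))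
    injective′ (suc i) zero    i<  _   eq = ⊥-elim (w∉p (i , ≤-pred i< , eq))
    injective′ (suc i) (suc j) i<  j<  eq = cong suc (injective i j (≤-pred i<) (≤-pred j<) eq)
    step′ : ∀ i → suc i < suc (suc L) → Adj G ((w ◃ p) i) ((w ◃ p) (suc i))
    step′ zero    _    = w~p0
    step′ (suc i) i+2< = step i (≤-pred i+2<)

  singleton-path : ∀ v → IsPath G 1 (const v)
  singleton-path v =
    (λ _ _ i<1 j<1 _ → trans (n<1⇒n≡0 i<1) (≡-sym (n<1⇒n≡0 j<1))) , λ { _ (s≤s ()) }

induced-path : ∀ {m} (G : Graph m) {S L p} → IsPath (G [ S ]) L p → IsPath G L p
induced-path G (injective , step) = injective , λ i i+1<L → proj₂ (proj₂ (step i i+1<L))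

record MaximalPath {m} (G : Graph m) (S : Subset m) : Set where
  field
    len     : ℕ
    vertex  : ℕ → Fin m
    isPath  : IsPath (G [ S ]) (suc len) vertex
    start∈S : vertex 0 ∈ S
    maximal : ∀ {w} → Adj (G [ S ]) (vertex 0) w → OnPath (suc len) vertex w

module _ {m} (G : Graph m) (S : Subset m) where
  open Paths (G [ S ])

  extend-maximally : ∀ k {len p} → m ≤ k + len → IsPath (G [ S ]) (suc len) p → p 0 ∈ S →
    MaximalPath G S
  extend-maximally zero {len} m≤len path _ =
    ⊥-elim (n≮n len (<-≤-trans (path-length≤ path) m≤len))
  extend-maximally (suc k) {len} {p} bound path p0∈S
    with any? (λ w → adj? (G [ S ]) (p 0) w ×-dec ¬? (on-path? (suc len) p w))
  ... | yes (w , p0~w , w∉p) =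
    extend-maximally k (subst (m ≤_) (≡-sym (+-suc k len)) bound)
      (prepend-path path (sym (G [ S ]) p0~w) w∉p) (proj₁ (proj₂ p0~w))
  ... | no cannot-extend = record
    { len     = len
    ; vertex  = p
    ; isPath  = path
    ; start∈S = p0∈S
    ; maximal = λ p0~w → decidable-stable (on-path? _ p _) (λ w∉p → cannot-extend (_ , p0~w , w∉p))
    }

  maximal-path-from : ∀ {v} → v ∈ S → MaximalPath G S
  maximal-path-from {v} v∈S = extend-maximally m (m≤m+n m 0) (singleton-path v) v∈S

one-other-neighbour⇒AtMostTwoNeighbours : ∀ {m} (G : Graph m) {v a : Fin m} →
  (∀ {w w′} → Adj G v w → Adj G v w′ → w ≢ a → w′ ≢ a → w ≡ w′) → AtMostTwoNeighbours G v
one-other-neighbour⇒AtMostTwoNeighbours G {v} {a} unique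
  with any? (λ w → adj? G v w ×-dec ¬? (w ≟ᶠ a))
... | yes (b , v~b , b≢a) = a , b , classify
  where
  classify : ∀ w → Adj G v w → w ≡ a ⊎ w ≡ b
  classify w v~w with w ≟ᶠ a
  ... | yes w≡a = inj₁ w≡a
  ... | no w≢a  = inj₂ (unique v~w v~b w≢a b≢a)
... | no no-other = a , a , λ w v~w →
  inj₁ (decidable-stable (w ≟ᶠ a) (λ w≢a → no-other (w , v~w , w≢a)))

SharedEdgeDeterminesCycle : ∀ {m} → Graph m → Set
SharedEdgeDeterminesCycle H = ∀ L p L′ p′ u v → IsCycle H L p → IsCycle H L′ p′ →
  CycleEdge L p u v → CycleEdge L′ p′ u v → ∀ x y → CycleEdge L p x y ⇔ CycleEdge L′ p′ x y

first-edge-on-cycle : ∀ {m k} {p : ℕ → Fin m} → 2 ≤ k → CycleEdge (suc k) p (p 0) (p 1)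
first-edge-on-cycle 2≤k = inj₁ (0 , s≤s (<⇒≤ 2≤k) , inj₁ (refl , refl))

module _ {m} (H : Graph m) where
  open Paths H

  prefix-cycle : ∀ {L p k} → IsPath H L p → 2 ≤ k → k < L → Adj H (p k) (p 0) → IsCycle H (suc k) p
  prefix-cycle path 2≤k k<L pk~p0 = s≤s 2≤k , path-prefix path k<L , pk~p0

  closing-edge∉longer-cycle : ∀ {L p i j} → IsPath H L p → 2 ≤ i → i < j → j < L →
    ¬ CycleEdge (suc j) p (p i) (p 0)
  closing-edge∉longer-cycle {p = p} {i} {j} (injective , _) 2≤i i<j j<L = λ
    { (inj₁ (t , t<j , inj₁ (_ , p0≡pt+1))) → 0≢1+n (index z≤n (≤-pred t<j) p0≡pt+1)
    ; (inj₁ (t , t<j , inj₂ (pi≡pt+1 , p0≡pt))) →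
        <-irrefl (≡-sym (trans (index i≤j (≤-pred t<j) pi≡pt+1)
                               (cong suc (≡-sym (index z≤n (<⇒≤ (≤-pred t<j)) p0≡pt))))) 2≤i
    ; (inj₂ (inj₁ (pi≡pj , _))) → <-irrefl (index i≤j ≤-refl pi≡pj) i<j
    ; (inj₂ (inj₂ (pi≡p0 , _))) → n≮0 (subst (1 <_) (index i≤j z≤n pi≡p0) 2≤i)
    }
    where
    i≤j = <⇒≤ i<j
    index : ∀ {a b} → a ≤ j → b ≤ j → p a ≡ p b → a ≡ b
    index a≤j b≤j = injective _ _ (≤-<-trans a≤j j<L) (≤-<-trans b≤j j<L)

  -- The cycles p 0 … p i and p 0 … p j share the edge p 0 p 1, but only the first contains p i p 0.
  no-two-back-edges : SharedEdgeDeterminesCycle H → ∀ {L p i j} → IsPath H L p →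
    2 ≤ i → i < j → j < L → Adj H (p i) (p 0) → Adj H (p j) (p 0) → ⊥
  no-two-back-edges cactus path 2≤i i<j j<L pi~p0 pj~p0 =
    closing-edge∉longer-cycle path 2≤i i<j j<L
      (Equivalence.to (cactus _ _ _ _ _ _ cycleᵢ cycleⱼ shared-edgeᵢ shared-edgeⱼ _ _)
        (inj₂ (inj₁ (refl , refl))))
    where
    2≤j = <-trans 2≤i i<j
    cycleᵢ = prefix-cycle path 2≤i (<-trans i<j j<L) pi~p0
    cycleⱼ = prefix-cycle path 2≤j j<L pj~p0
    shared-edgeᵢ = first-edge-on-cycle 2≤i
    shared-edgeⱼ = first-edge-on-cycle 2≤j

module _ {m} {H : Graph m} (cactus : SharedEdgeDeterminesCycle H) {S : Subset m}
         (P : MaximalPath H S) where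
  open MaximalPath P

  private
    path : IsPath H (suc len) vertex
    path = induced-path H isPath

    back : ∀ {w} → Adj (H [ S ]) (vertex 0) w → Adj H w (vertex 0)
    back = sym H ∘ proj₂ ∘ proj₂

  later-index : ∀ {w} → Adj (H [ S ]) (vertex 0) w → w ≢ vertex 1 →
    ∃[ i ] (2 ≤ i × i < suc len × vertex i ≡ w)
  later-index p0~w w≢p1 with maximal p0~w
  ... | zero , _ , p0≡w = ⊥-elim (irrefl (H [ S ]) p0≡w p0~w)
  ... | suc zero , _ , p1≡w = ⊥-elim (w≢p1 (≡-sym p1≡w))
  ... | suc (suc i) , i<L , pi≡w = suc (suc i) , s≤s (s≤s z≤n) , i<L , pi≡w

  one-later-neighbour : ∀ {w w′} → Adj (H [ S ]) (vertex 0) w → Adj (H [ S ]) (vertex 0) w′ →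
    w ≢ vertex 1 → w′ ≢ vertex 1 → w ≡ w′
  one-later-neighbour p0~w p0~w′ w≢p1 w′≢p1
    with later-index p0~w w≢p1 | later-index p0~w′ w′≢p1
  ... | i , 2≤i , i<L , refl | j , 2≤j , j<L , refl with <-cmp i j
  ... | tri< i<j _ _  = ⊥-elim (no-two-back-edges H cactus path 2≤i i<j j<L (back p0~w) (back p0~w′))
  ... | tri≈ _ refl _ = refl
  ... | tri> _ _ j<i  = ⊥-elim (no-two-back-edges H cactus path 2≤j j<i i<L (back p0~w′) (back p0~w))

  start-has-at-most-two-neighbours : AtMostTwoNeighbours (H [ S ]) (vertex 0)
  start-has-at-most-two-neighbours =
    one-other-neighbour⇒AtMostTwoNeighbours (H [ S ]) one-later-neighbour

cactus⇒twoDegenerate : ∀ {m} (H : Graph m) → SharedEdgeDeterminesCycle H → TwoDegenerate H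
cactus⇒twoDegenerate H cactus S (v , v∈S) =
  vertex 0 , start∈S , start-has-at-most-two-neighbours cactus P
  where
  P = maximal-path-from H S v∈S
  open MaximalPath P

proper⇒compatible : ∀ {n m} (T : Graph m) (ψ : Fin n → Fin m) {c : Fin m → Fin 3} →
  ProperColouring T c → Compatible T ψ (c ∘ ψ)
proper⇒compatible T ψ {c} proper =
  (λ _ _ → cong c) ,
  (λ _ _ ψu~ψv _ _ → proper ψu~ψv) ,
  λ k p ((_ , step) , _) _ _ _ →
    (λ _ _ ψu≡p0 ψv≡p1 →
      proper (subst₂ (Adj T) (≡-sym ψu≡p0) (≡-sym ψv≡p1) (step 0 (s≤s (s≤s z≤n))))) ,
    (λ _ _ ψu≡pk+2 ψv≡pk+1 →
      proper (subst₂ (Adj T) (≡-sym ψu≡pk+2) (≡-sym ψv≡pk+1) (sym T (step (1 + k) ≤-refl))))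

lemma1 : ∀ {n m} (G : Graph n) (F : EdgeSet G) (H : Graph m) (ψ : Fin n → Fin m) →
    IsContraction G F H ψ → IsCactus H →
    ∃[ f ] Compatible H ψ f
lemma1 G F H ψ _ (_ , cactus) with twoDegenerate⇒3-colourable H (cactus⇒twoDegenerate H cactus)
... | c , proper = c ∘ ψ , proper⇒compatible H ψ proper
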